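{- Let $S = \mathbf{k}[x_1,\dots,x_n]$ with $\deg x_i = 1$, let $I \subset S$ be a homogeneous ideal, $w \in S_1$ a linear form and $k \ge 2$ an integer. If the multiplication map $\times w : (S/I)_{k-1} \to (S/I)_k$ is injective, then $\mu_k(I) = \mu_k(I + (w))$.
   Context: $\mathbf{k}$ is a field, $\mathfrak m = (x_1,\dots,x_n)$ is the graded maximal ideal of $S$, and for a homogeneous ideal $I$, $\mu_k(I) = \dim_{\mathbf{k}} (I/\mathfrak m I)_k$ is the number of degree-$k$ elements in a minimal homogeneous generating set of $I$. -}

module Defs where

open import Level using (Level; _⊔_; suc)
open import Algebra.Bundles using (CommutativeRing)
open import Data.Nat as ℕ using (ℕ; _∸_)
open import Data.Fin as F using (Fin)
open import Data.Vec using (Vec; zipWith; foldr; replicate; updateAt)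
open import Data.Vec.Properties using (≡-dec)
open import Data.List as List using (List; []; _∷_; _++_; map; concatMap)
open import Data.Product using (_×_; _,_; Σ; ∃; ∃-syntax; proj₁; proj₂)
open import Data.Sum using (_⊎_)
open import Relation.Nullary using (¬_; yes; no)
open import Relation.Binary.PropositionalEquality using (_≡_)
open import Function.Bundles using (_⇔_)

record Field (c ℓ : Level) : Set (suc (c ⊔ ℓ)) where
  field
    commutativeRing : CommutativeRing c ℓ
  open CommutativeRing commutativeRing public
  field
    0≉1     : ¬ (0# ≈ 1#)
    inverse : ∀ x → ¬ (x ≈ 0#) → ∃[ y ] (x * y ≈ 1#)

-- The polynomial ring S = K[x₁,…,xₙ] with deg xᵢ = 1.
-- A polynomial is a finite formal sum of terms  c · x^e  (a list of
-- coefficient/exponent-vector pairs); two polynomials are equal when all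
-- their coefficients agree.

module Poly {c ℓ} (K : Field c ℓ) (n : ℕ) where
  open Field K

  Monomial : Set
  Monomial = Vec ℕ n

  deg : Monomial → ℕ
  deg = foldr _ ℕ._+_ 0

  Pol : Set c
  Pol = List (Carrier × Monomial)

  coeff : Pol → Monomial → Carrier
  coeff []             m = 0#
  coeff ((a , e) ∷ p)  m with ≡-dec ℕ._≟_ e m
  ... | yes _ = a + coeff p m
  ... | no  _ = coeff p m

  _≈ₚ_ : Pol → Pol → Set ℓ
  p ≈ₚ q = ∀ m → coeff p m ≈ coeff q m

  0ₚ : Pol
  0ₚ = []

  _+ₚ_ : Pol → Pol → Pol
  _+ₚ_ = _++_

  -ₚ_ : Pol → Pol
  -ₚ_ = map (λ { (a , e) → (- a , e) })

  _-ₚ_ : Pol → Pol → Pol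
  p -ₚ q = p +ₚ (-ₚ q)

  _*ₚ_ : Pol → Pol → Pol
  p *ₚ q = concatMap (λ { (a , e) → map (λ { (b , f) → (a * b , zipWith ℕ._+_ e f) }) q }) p

  _·_ : Carrier → Pol → Pol
  a · p = map (λ { (b , e) → (a * b , e) }) p

  var : Fin n → Pol
  var i = (1# , updateAt (replicate n 0) i (λ _ → 1)) ∷ []

  component : ℕ → Pol → Pol
  component d = List.filter (λ { (a , e) → deg e ℕ.≟ d })

  Homogeneous : ℕ → Pol → Set ℓ
  Homogeneous d p = p ≈ₚ component d p

  lincomb : ∀ {r} → (Fin r → Carrier) → (Fin r → Pol) → Pol
  lincomb {ℕ.zero}  c v = 0ₚ
  lincomb {ℕ.suc r} c v = (c F.zero · v F.zero) +ₚ
                          lincomb (λ j → c (F.suc j)) (λ j → v (F.suc j))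

  record Ideal : Set (suc (c ⊔ ℓ)) where
    field
      _∈I     : Pol → Set (c ⊔ ℓ)
      resp    : ∀ {p q} → p ≈ₚ q → p ∈I → q ∈I
      zero∈   : 0ₚ ∈I
      +-closed : ∀ {p q} → p ∈I → q ∈I → (p +ₚ q) ∈I
      *-closed : ∀ f {p} → p ∈I → (f *ₚ p) ∈I

  open Ideal public

  IsHomogeneous : Ideal → Set (c ⊔ ℓ)
  IsHomogeneous I = ∀ d p → _∈I I p → _∈I I (component d p)

  Generated : (Pol → Set (c ⊔ ℓ)) → Pol → Set (c ⊔ ℓ)
  Generated G p = ∃[ r ] Σ (Fin r → Pol) λ a → Σ (Fin r → Pol) λ g →
                    (∀ j → G (g j)) × (p ≈ₚ gsum a g)
    where
      gsum : ∀ {r} → (Fin r → Pol) → (Fin r → Pol) → Pol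
      gsum {ℕ.zero}  a g = 0ₚ
      gsum {ℕ.suc r} a g = (a F.zero *ₚ g F.zero) +ₚ
                           gsum (λ j → a (F.suc j)) (λ j → g (F.suc j))

  _∈mI_ : Pol → Ideal → Set (c ⊔ ℓ)
  p ∈mI I = Generated (λ q → ∃[ i ] ∃[ f ] (_∈I I f × (q ≈ₚ (var i *ₚ f)))) p

  _∈I+⟨_⟩_ : Pol → Pol → Ideal → Set (c ⊔ ℓ)
  p ∈I+⟨ w ⟩ I = Generated (λ q → _∈I I q ⊎ Lift' (q ≈ₚ w)) p
    where
      Lift' : Set ℓ → Set (c ⊔ ℓ)
      Lift' A = Level.Lift c A

  _∈m[I+⟨_⟩]_ : Pol → Pol → Ideal → Set (c ⊔ ℓ)
  p ∈m[I+⟨ w ⟩] I =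
    Generated (λ q → ∃[ i ] ∃[ f ] ((f ∈I+⟨ w ⟩ I) × (q ≈ₚ (var i *ₚ f)))) p

  -- dim_K (V/W)_k = d, for subsets W ⊆ V of S: there are d degree-k
  -- elements of V whose classes form a K-basis of (V/W)_k = V_k / W_k.
  DimQuotientDeg : (V W : Pol → Set (c ⊔ ℓ)) → (k d : ℕ) → Set (c ⊔ ℓ)
  DimQuotientDeg V W k d = Σ (Fin d → Pol) λ v →
      (∀ j → V (v j) × Homogeneous k (v j))
    × (∀ (a : Fin d → Carrier) → W (lincomb a v) → ∀ j → a j ≈ 0#)
    × (∀ p → V p → Homogeneous k p →
         ∃[ a ] W (p -ₚ lincomb a v))

  μ[_]_≡_ : ℕ → Ideal → ℕ → Set (c ⊔ ℓ)
  μ[ k ] I ≡ d = DimQuotientDeg (_∈I I) (_∈mI I) k d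

  μ[_]I+⟨_⟩_≡_ : ℕ → Pol → Ideal → ℕ → Set (c ⊔ ℓ)
  μ[ k ]I+⟨ w ⟩ I ≡ d = DimQuotientDeg (λ p → p ∈I+⟨ w ⟩ I) (λ p → p ∈m[I+⟨ w ⟩] I) k d

-- Write J = I + (w) and m = (x₁,…,xₙ). Every element of J is i + g w with i ∈ I, and every
-- element of m J is i + h w with i ∈ m I. Let p ∈ I be homogeneous of degree k and lie in m J.
-- Taking degree-k parts, p = i + h w with i ∈ (m I)_k and h of degree k − 1; then h w = p − i
-- lies in I, so h ∈ I by the injectivity of × w, and h w ∈ m I because w ∈ m. Hence
-- I_k ∩ (m J)_k = (m I)_k. On the other hand J_k = I_k + (m J)_k, since h w ∈ m J once h has
-- positive degree k − 1. So the inclusion I_k ⊆ J_k induces an isomorphism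
-- (I / m I)_k ≅ (J / m J)_k, and a basis of either quotient lifts to one of the other.

module Submission where

open import Defs
open import Level using (Level; _⊔_; Lift; lift)
open import Function.Bundles using (_⇔_; mk⇔)
open import Data.Nat as ℕ using (ℕ; zero; suc; _∸_; _≤_; z≤n; s≤s)
import Data.Nat.Properties as ℕ
open import Data.Fin as Fin using (Fin)
open import Data.Vec as Vec using (Vec; []; _∷_; zipWith; replicate; updateAt)
import Data.Vec.Properties as Vec
open import Data.Product using (∃-syntax; _×_; _,_; proj₁; proj₂)
open import Data.Sum using (_⊎_; inj₁; inj₂)
open import Relation.Binary.PropositionalEquality as ≡ using (_≡_; _≢_)
open import Relation.Binary.Bundles using (Setoid)
open import Relation.Binary.Structures using (IsEquivalence)
import Relation.Binary.Reasoning.Setoid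
open import Relation.Nullary using (¬_; yes; no; contradiction)
open import Data.List as List using (List; []; _∷_; _++_; map)
import Data.List.Properties as List
import Algebra.Properties.CommutativeSemigroup as CommutativeSemigroupProperties
import Algebra.Properties.AbelianGroup
import Algebra.Properties.Ring

-- Exponent arithmetic

m+n∸o≡m⇒o≡n : ∀ m n {o} → o ≤ m ℕ.+ n → m ℕ.+ n ∸ o ≡ m → o ≡ n
m+n∸o≡m⇒o≡n m n {o} o≤m+n m+n∸o≡m = ℕ.+-cancelˡ-≡ m o n (begin
  m ℕ.+ o                ≡⟨ ℕ.+-comm m o ⟩
  o ℕ.+ m                ≡⟨ ≡.cong (o ℕ.+_) m+n∸o≡m ⟨
  o ℕ.+ (m ℕ.+ n ∸ o)    ≡⟨ ℕ.m+[n∸m]≡n o≤m+n ⟩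
  m ℕ.+ n                ∎)
  where open ≡.≡-Reasoning

infixl 6 _⊕_ _⊖_

_⊕_ : ∀ {k} → Vec ℕ k → Vec ℕ k → Vec ℕ k
_⊕_ = zipWith ℕ._+_

unit : ∀ {k} → Fin k → Vec ℕ k
unit {k} i = updateAt (replicate k 0) i (λ _ → 1)

⊕-comm : ∀ {k} (e f : Vec ℕ k) → e ⊕ f ≡ f ⊕ e
⊕-comm = Vec.zipWith-comm ℕ.+-comm

⊕-assoc : ∀ {k} (e f g : Vec ℕ k) → (e ⊕ f) ⊕ g ≡ e ⊕ (f ⊕ g)
⊕-assoc = Vec.zipWith-assoc ℕ.+-assoc

⊕-identityˡ : ∀ {k} (e : Vec ℕ k) → replicate k 0 ⊕ e ≡ e
⊕-identityˡ = Vec.zipWith-identityˡ ℕ.+-identityˡ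

_⊖_ : ∀ {k} → Vec ℕ k → Vec ℕ k → Vec ℕ k
_⊖_ = zipWith _∸_

[e⊕f]⊖e≡f : ∀ {k} (e f : Vec ℕ k) → (e ⊕ f) ⊖ e ≡ f
[e⊕f]⊖e≡f []       []       = ≡.refl
[e⊕f]⊖e≡f (x ∷ e) (y ∷ f) = ≡.cong₂ _∷_ (ℕ.m+n∸m≡n x y) ([e⊕f]⊖e≡f e f)

sum-⊕ : ∀ {k} (e f : Vec ℕ k) → Vec.sum (e ⊕ f) ≡ Vec.sum e ℕ.+ Vec.sum f
sum-⊕ []       []       = ≡.refl
sum-⊕ (x ∷ e) (y ∷ f) =
  ≡.trans (≡.cong (x ℕ.+ y ℕ.+_) (sum-⊕ e f)) (interchange x y (Vec.sum e) (Vec.sum f))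
  where open CommutativeSemigroupProperties ℕ.+-commutativeSemigroup using (interchange)

sum-unit : ∀ {k} (i : Fin k) → Vec.sum (unit i) ≡ 1
sum-unit {suc k} Fin.zero    = ≡.cong suc (sum-zeros k)
  where
  sum-zeros : ∀ k → Vec.sum (replicate k 0) ≡ 0
  sum-zeros zero    = ≡.refl
  sum-zeros (suc k) = sum-zeros k
sum-unit {suc k} (Fin.suc i) = sum-unit i

1≤sum⇒unit⊕ : ∀ {k} (e : Vec ℕ k) → 1 ≤ Vec.sum e → ∃[ i ] ∃[ f ] (e ≡ unit i ⊕ f)
1≤sum⇒unit⊕ (suc x ∷ e) _ = Fin.zero , x ∷ e , ≡.cong (suc x ∷_) (≡.sym (⊕-identityˡ e))
1≤sum⇒unit⊕ (zero ∷ e) h with 1≤sum⇒unit⊕ e h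
... | i , f , e≡ = Fin.suc i , 0 ∷ f , ≡.cong (0 ∷_) e≡

-- Polynomials up to coefficientwise equality

module Polynomials {c ℓ} (K : Field c ℓ) (n : ℕ) where
  open Field K
  open Poly K n
  private
    module ≈ = Relation.Binary.Reasoning.Setoid setoid
    module +-AG = Algebra.Properties.AbelianGroup +-abelianGroup
    open Algebra.Properties.Ring ring using (-1*x≈-x)
    open CommutativeSemigroupProperties +-commutativeSemigroup renaming (interchange to +-interchange)

  infix 4 _≃_

  record _≃_ (p q : Pol) : Set ℓ where
    constructor ≈ₚ⇒≃
    field ≃⇒≈ₚ : p ≈ₚ q
  open _≃_ public

  ≃-isEquivalence : IsEquivalence _≃_
  ≃-isEquivalence = record
    { refl  = ≈ₚ⇒≃ λ _ → refl
    ; sym   = λ p≃q → ≈ₚ⇒≃ λ m → sym (≃⇒≈ₚ p≃q m)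
    ; trans = λ p≃q q≃r → ≈ₚ⇒≃ λ m → trans (≃⇒≈ₚ p≃q m) (≃⇒≈ₚ q≃r m)
    }

  ≃-setoid : Setoid c ℓ
  ≃-setoid = record { isEquivalence = ≃-isEquivalence }

  open IsEquivalence ≃-isEquivalence public
    using () renaming (refl to ≃-refl; sym to ≃-sym; trans to ≃-trans; reflexive to ≡⇒≃)

  module ≃-Reasoning = Relation.Binary.Reasoning.Setoid ≃-setoid

  δ : Monomial → Monomial → Carrier → Carrier
  δ e m a with Vec.≡-dec ℕ._≟_ e m
  ... | yes _ = a
  ... | no  _ = 0#

  δ-≡ : ∀ {e m} a → e ≡ m → δ e m a ≈ a
  δ-≡ {e} {m} a e≡m with Vec.≡-dec ℕ._≟_ e m
  ... | yes _   = refl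
  ... | no  e≢m = contradiction e≡m e≢m

  δ-≢ : ∀ {e m} a → e ≢ m → δ e m a ≈ 0#
  δ-≢ {e} {m} a e≢m with Vec.≡-dec ℕ._≟_ e m
  ... | yes e≡m = contradiction e≡m e≢m
  ... | no  _   = refl

  δ-congʳ : ∀ e m {a b} → a ≈ b → δ e m a ≈ δ e m b
  δ-congʳ e m a≈b with Vec.≡-dec ℕ._≟_ e m
  ... | yes _ = a≈b
  ... | no  _ = refl

  δ-homo : ∀ (f : Carrier → Carrier) → f 0# ≈ 0# → ∀ e m a → δ e m (f a) ≈ f (δ e m a)
  δ-homo f f0≈0 e m a with Vec.≡-dec ℕ._≟_ e m
  ... | yes _ = refl
  ... | no  _ = sym f0≈0

  coeff-∷ : ∀ a e p m → coeff ((a , e) ∷ p) m ≈ δ e m a + coeff p m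
  coeff-∷ a e p m with Vec.≡-dec ℕ._≟_ e m
  ... | yes _ = refl
  ... | no  _ = sym (+-identityˡ _)

  coeff-++ : ∀ p q m → coeff (p ++ q) m ≈ coeff p m + coeff q m
  coeff-++ []            q m = sym (+-identityˡ _)
  coeff-++ ((a , e) ∷ p) q m = begin
    coeff ((a , e) ∷ (p ++ q)) m       ≈⟨ coeff-∷ a e (p ++ q) m ⟩
    δ e m a + coeff (p ++ q) m         ≈⟨ +-congˡ (coeff-++ p q m) ⟩
    δ e m a + (coeff p m + coeff q m)  ≈⟨ +-assoc _ _ _ ⟨
    (δ e m a + coeff p m) + coeff q m  ≈⟨ +-congʳ (coeff-∷ a e p m) ⟨
    coeff ((a , e) ∷ p) m + coeff q m  ∎
    where open ≈

  coeff-neg : ∀ p m → coeff (-ₚ p) m ≈ - coeff p m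
  coeff-neg []            m = sym +-AG.ε⁻¹≈ε
  coeff-neg ((a , e) ∷ p) m = begin
    coeff ((- a , e) ∷ (-ₚ p)) m    ≈⟨ coeff-∷ (- a) e (-ₚ p) m ⟩
    δ e m (- a) + coeff (-ₚ p) m    ≈⟨ +-cong (δ-homo -_ +-AG.ε⁻¹≈ε e m a) (coeff-neg p m) ⟩
    - δ e m a + - coeff p m         ≈⟨ +-AG.⁻¹-∙-comm _ _ ⟩
    - (δ e m a + coeff p m)         ≈⟨ -‿cong (coeff-∷ a e p m) ⟨
    - coeff ((a , e) ∷ p) m         ∎
    where open ≈

  coeff-· : ∀ b p m → coeff (b · p) m ≈ b * coeff p m
  coeff-· b []            m = sym (zeroʳ b)
  coeff-· b ((a , e) ∷ p) m = begin
    coeff ((b * a , e) ∷ (b · p)) m  ≈⟨ coeff-∷ (b * a) e (b · p) m ⟩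
    δ e m (b * a) + coeff (b · p) m  ≈⟨ +-cong (δ-homo (b *_) (zeroʳ b) e m a) (coeff-· b p m) ⟩
    b * δ e m a + b * coeff p m      ≈⟨ distribˡ b _ _ ⟨
    b * (δ e m a + coeff p m)        ≈⟨ *-congˡ (coeff-∷ a e p m) ⟨
    b * coeff ((a , e) ∷ p) m        ∎
    where open ≈

  ∷-cong : ∀ {a b e e' p q} → a ≈ b → e ≡ e' → p ≃ q → ((a , e) ∷ p) ≃ ((b , e') ∷ q)
  ∷-cong {a} {b} {e} {p = p} {q} a≈b ≡.refl p≃q = ≈ₚ⇒≃ λ m → begin
    coeff ((a , e) ∷ p) m  ≈⟨ coeff-∷ a e p m ⟩
    δ e m a + coeff p m    ≈⟨ +-cong (δ-congʳ e m a≈b) (≃⇒≈ₚ p≃q m) ⟩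
    δ e m b + coeff q m    ≈⟨ coeff-∷ b e q m ⟨
    coeff ((b , e) ∷ q) m  ∎
    where open ≈

  coeff-∷-congʳ : ∀ a e {p q} m → coeff p m ≈ coeff q m → coeff ((a , e) ∷ p) m ≈ coeff ((a , e) ∷ q) m
  coeff-∷-congʳ a e {p} {q} m p≈q =
    trans (coeff-∷ a e p m) (trans (+-congˡ p≈q) (sym (coeff-∷ a e q m)))

  coeff-++-congʳ : ∀ r {p q} m → coeff p m ≈ coeff q m → coeff (r ++ p) m ≈ coeff (r ++ q) m
  coeff-++-congʳ r {p} {q} m p≈q =
    trans (coeff-++ r p m) (trans (+-congˡ p≈q) (sym (coeff-++ r q m)))

  ++-cong : ∀ {p p' q q'} → p ≃ p' → q ≃ q' → (p ++ q) ≃ (p' ++ q')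
  ++-cong {p} {p'} {q} {q'} p≃p' q≃q' = ≈ₚ⇒≃ λ m → begin
    coeff (p ++ q) m         ≈⟨ coeff-++ p q m ⟩
    coeff p m + coeff q m    ≈⟨ +-cong (≃⇒≈ₚ p≃p' m) (≃⇒≈ₚ q≃q' m) ⟩
    coeff p' m + coeff q' m  ≈⟨ coeff-++ p' q' m ⟨
    coeff (p' ++ q') m       ∎
    where open ≈

  ++-comm : ∀ p q → (p ++ q) ≃ (q ++ p)
  ++-comm p q = ≈ₚ⇒≃ λ m →
    trans (coeff-++ p q m) (trans (+-comm _ _) (sym (coeff-++ q p m)))

  ++-interchange : ∀ p q r s → ((p ++ q) ++ (r ++ s)) ≃ ((p ++ r) ++ (q ++ s))
  ++-interchange p q r s = ≈ₚ⇒≃ λ m → begin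
    coeff ((p ++ q) ++ (r ++ s)) m                         ≈⟨ coeff-++ (p ++ q) (r ++ s) m ⟩
    coeff (p ++ q) m + coeff (r ++ s) m                    ≈⟨ +-cong (coeff-++ p q m) (coeff-++ r s m) ⟩
    (coeff p m + coeff q m) + (coeff r m + coeff s m)      ≈⟨ +-interchange _ _ _ _ ⟩
    (coeff p m + coeff r m) + (coeff q m + coeff s m)      ≈⟨ +-cong (coeff-++ p r m) (coeff-++ q s m) ⟨
    coeff (p ++ r) m + coeff (q ++ s) m                    ≈⟨ coeff-++ (p ++ r) (q ++ s) m ⟨
    coeff ((p ++ r) ++ (q ++ s)) m                         ∎
    where open ≈

  ·-cong : ∀ b {p q} → p ≃ q → (b · p) ≃ (b · q)
  ·-cong b {p} {q} p≃q = ≈ₚ⇒≃ λ m →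
    trans (coeff-· b p m) (trans (*-congˡ (≃⇒≈ₚ p≃q m)) (sym (coeff-· b q m)))

  ++-swapˡ : ∀ p q r → (p ++ (q ++ r)) ≃ (q ++ (p ++ r))
  ++-swapˡ p q r = begin
    p ++ (q ++ r)  ≡⟨ List.++-assoc p q r ⟨
    (p ++ q) ++ r  ≈⟨ ++-cong (++-comm p q) ≃-refl ⟩
    (q ++ p) ++ r  ≡⟨ List.++-assoc q p r ⟩
    q ++ (p ++ r)  ∎
    where open ≃-Reasoning

  ++-swapʳ : ∀ p q r → ((p ++ q) ++ r) ≃ ((p ++ r) ++ q)
  ++-swapʳ p q r = begin
    (p ++ q) ++ r  ≡⟨ List.++-assoc p q r ⟩
    p ++ (q ++ r)  ≈⟨ ++-cong (≃-refl {p}) (++-comm q r) ⟩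
    p ++ (r ++ q)  ≡⟨ List.++-assoc p r q ⟨
    (p ++ r) ++ q  ∎
    where open ≃-Reasoning

  coeff-ₚ : ∀ p q m → coeff (p -ₚ q) m ≈ coeff p m - coeff q m
  coeff-ₚ p q m = trans (coeff-++ p (-ₚ q) m) (+-congˡ (coeff-neg q m))

  p≃q++r⇒r≃p-q : ∀ {p q r} → p ≃ q ++ r → r ≃ p -ₚ q
  p≃q++r⇒r≃p-q {p} {q} {r} p≃q++r = ≈ₚ⇒≃ λ m → begin
    coeff r m                ≈⟨ +-AG.y≈x\\z (coeff q m) (coeff r m) (coeff p m)
                                  (sym (trans (≃⇒≈ₚ p≃q++r m) (coeff-++ q r m))) ⟩
    - coeff q m + coeff p m  ≈⟨ +-comm _ _ ⟩
    coeff p m - coeff q m    ≈⟨ coeff-ₚ p q m ⟨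
    coeff (p -ₚ q) m         ∎
    where open ≈

  q≃s++t⇒p-s≃[p-q]++t : ∀ p {q s t} → q ≃ s ++ t → p -ₚ s ≃ (p -ₚ q) ++ t
  q≃s++t⇒p-s≃[p-q]++t p {q} {s} {t} q≃s++t = ≈ₚ⇒≃ λ m → begin
    coeff (p -ₚ s) m
      ≈⟨ coeff-ₚ p s m ⟩
    coeff p m - coeff s m
      ≈⟨ +-congˡ (+-identityʳ _) ⟨
    coeff p m + (- coeff s m + 0#)
      ≈⟨ +-congˡ (+-congˡ (-‿inverseˡ (coeff t m))) ⟨
    coeff p m + (- coeff s m + (- coeff t m + coeff t m))
      ≈⟨ +-congˡ (+-assoc _ _ _) ⟨
    coeff p m + ((- coeff s m - coeff t m) + coeff t m)
      ≈⟨ +-congˡ (+-congʳ (+-AG.⁻¹-∙-comm _ _)) ⟩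
    coeff p m + (- (coeff s m + coeff t m) + coeff t m)
      ≈⟨ +-assoc _ _ _ ⟨
    (coeff p m - (coeff s m + coeff t m)) + coeff t m
      ≈⟨ +-congʳ (+-congˡ (-‿cong (trans (≃⇒≈ₚ q≃s++t m) (coeff-++ s t m)))) ⟨
    (coeff p m - coeff q m) + coeff t m
      ≈⟨ +-congʳ (coeff-ₚ p q m) ⟨
    coeff (p -ₚ q) m + coeff t m
      ≈⟨ coeff-++ (p -ₚ q) t m ⟨
    coeff ((p -ₚ q) ++ t) m ∎
    where open ≈

  ·-++ : ∀ b p q → b · (p ++ q) ≡ b · p ++ b · q
  ·-++ b = List.map-++ _

  lincomb-cong : ∀ {r} (a : Fin r → Carrier) {u v : Fin r → Pol} → (∀ j → u j ≃ v j) →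
                 lincomb a u ≃ lincomb a v
  lincomb-cong {zero}  a u≃v = ≃-refl
  lincomb-cong {suc r} a u≃v =
    ++-cong (·-cong (a Fin.zero) (u≃v Fin.zero)) (lincomb-cong (λ j → a (Fin.suc j)) (λ j → u≃v (Fin.suc j)))

  lincomb-++ : ∀ {r} (a : Fin r → Carrier) u v → lincomb a (λ j → u j ++ v j) ≃ lincomb a u ++ lincomb a v
  lincomb-++ {zero}  a u v = ≃-refl
  lincomb-++ {suc r} a u v = begin
    a₀ · (u₀ ++ v₀) ++ lincomb a' (λ j → u' j ++ v' j)
      ≈⟨ ++-cong (≡⇒≃ (·-++ a₀ u₀ v₀)) (lincomb-++ a' u' v') ⟩
    (a₀ · u₀ ++ a₀ · v₀) ++ (lincomb a' u' ++ lincomb a' v')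
      ≈⟨ ++-interchange (a₀ · u₀) (a₀ · v₀) _ _ ⟩
    (a₀ · u₀ ++ lincomb a' u') ++ (a₀ · v₀ ++ lincomb a' v') ∎
    where
    open ≃-Reasoning
    a₀ : Carrier
    a₀ = a Fin.zero
    u₀ v₀ : Pol
    u₀ = u Fin.zero
    v₀ = v Fin.zero
    a' : Fin r → Carrier
    a' j = a (Fin.suc j)
    u' v' : Fin r → Pol
    u' j = u (Fin.suc j)
    v' j = v (Fin.suc j)

  -- Multiplication

  Term : Set c
  Term = Carrier × Monomial

  infixr 7 _⋆_

  _⋆_ : Term → Pol → Pol
  (a , e) ⋆ q = map (λ { (b , f) → a * b , e ⊕ f }) q

  *ₚ-zeroʳ : ∀ p → p *ₚ [] ≡ []
  *ₚ-zeroʳ []      = ≡.refl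
  *ₚ-zeroʳ (_ ∷ p) = *ₚ-zeroʳ p

  ⋆-++ : ∀ t p q → t ⋆ (p ++ q) ≡ t ⋆ p ++ t ⋆ q
  ⋆-++ (a , e) = List.map-++ _

  *ₚ-distribʳ : ∀ p q r → (p ++ q) *ₚ r ≡ p *ₚ r ++ q *ₚ r
  *ₚ-distribʳ p q r = List.concatMap-++ _ p q

  -- With truncated subtraction, e ⊕ (m ⊖ e) ≡ m says that the monomial e divides m.
  coeff-⋆ : ∀ a e q m → e ⊕ (m ⊖ e) ≡ m → coeff ((a , e) ⋆ q) m ≈ a * coeff q (m ⊖ e)
  coeff-⋆ a e []            m _     = sym (zeroʳ a)
  coeff-⋆ a e ((b , f) ∷ q) m e|m = begin
    coeff ((a * b , e ⊕ f) ∷ (a , e) ⋆ q) m                ≈⟨ coeff-∷ (a * b) (e ⊕ f) ((a , e) ⋆ q) m ⟩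
    δ (e ⊕ f) m (a * b) + coeff ((a , e) ⋆ q) m            ≈⟨ +-cong δ-⊕ (coeff-⋆ a e q m e|m) ⟩
    a * δ f (m ⊖ e) b + a * coeff q (m ⊖ e)                ≈⟨ distribˡ a _ _ ⟨
    a * (δ f (m ⊖ e) b + coeff q (m ⊖ e))                  ≈⟨ *-congˡ (coeff-∷ b f q (m ⊖ e)) ⟨
    a * coeff ((b , f) ∷ q) (m ⊖ e)                        ∎
    where
    open ≈
    δ-⊕ : δ (e ⊕ f) m (a * b) ≈ a * δ f (m ⊖ e) b
    δ-⊕ with Vec.≡-dec ℕ._≟_ (e ⊕ f) m
    ... | yes e⊕f≡m =
      *-congˡ (sym (δ-≡ b (≡.trans (≡.sym ([e⊕f]⊖e≡f e f)) (≡.cong (_⊖ e) e⊕f≡m))))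
    ... | no  e⊕f≢m =
      sym (trans (*-congˡ (δ-≢ b λ f≡m⊖e → e⊕f≢m (≡.trans (≡.cong (e ⊕_) f≡m⊖e) e|m))) (zeroʳ a))

  coeff-⋆-∤ : ∀ a e q m → e ⊕ (m ⊖ e) ≢ m → coeff ((a , e) ⋆ q) m ≈ 0#
  coeff-⋆-∤ a e []            m _     = refl
  coeff-⋆-∤ a e ((b , f) ∷ q) m e∤m = begin
    coeff ((a * b , e ⊕ f) ∷ (a , e) ⋆ q) m      ≈⟨ coeff-∷ (a * b) (e ⊕ f) ((a , e) ⋆ q) m ⟩
    δ (e ⊕ f) m (a * b) + coeff ((a , e) ⋆ q) m  ≈⟨ +-cong (δ-≢ (a * b) e⊕f≢m) (coeff-⋆-∤ a e q m e∤m) ⟩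
    0# + 0#                                      ≈⟨ +-identityˡ 0# ⟩
    0#                                           ∎
    where
    open ≈
    e⊕f≢m : e ⊕ f ≢ m
    e⊕f≢m e⊕f≡m =
      e∤m (≡.subst (λ x → e ⊕ (x ⊖ e) ≡ x) e⊕f≡m (≡.cong (e ⊕_) ([e⊕f]⊖e≡f e f)))

  ⋆-congʳ : ∀ t {p q} → p ≃ q → t ⋆ p ≃ t ⋆ q
  ⋆-congʳ (a , e) {p} {q} p≃q = ≈ₚ⇒≃ λ m → case m
    where
    case : ∀ m → coeff ((a , e) ⋆ p) m ≈ coeff ((a , e) ⋆ q) m
    case m with Vec.≡-dec ℕ._≟_ (e ⊕ (m ⊖ e)) m
    ... | yes e|m = trans (coeff-⋆ a e p m e|m) (trans (*-congˡ (≃⇒≈ₚ p≃q _)) (sym (coeff-⋆ a e q m e|m)))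
    ... | no  e∤m = trans (coeff-⋆-∤ a e p m e∤m) (sym (coeff-⋆-∤ a e q m e∤m))

  *ₚ-congˡ : ∀ p {q r} → q ≃ r → p *ₚ q ≃ p *ₚ r
  *ₚ-congˡ []      q≃r = ≃-refl
  *ₚ-congˡ (t ∷ p) q≃r = ++-cong (⋆-congʳ t q≃r) (*ₚ-congˡ p q≃r)

  *ₚ-∷ʳ : ∀ p t q → p *ₚ (t ∷ q) ≃ t ⋆ p ++ p *ₚ q
  *ₚ-∷ʳ []            t q = ≃-refl
  *ₚ-∷ʳ ((b , f) ∷ p) (a , e) q = begin
    (b * a , f ⊕ e) ∷ ((b , f) ⋆ q ++ p *ₚ ((a , e) ∷ q))
      ≈⟨ ∷-cong refl ≡.refl (++-cong ≃-refl (*ₚ-∷ʳ p (a , e) q)) ⟩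
    (b * a , f ⊕ e) ∷ ((b , f) ⋆ q ++ ((a , e) ⋆ p ++ p *ₚ q))
      ≈⟨ ∷-cong (*-comm b a) (⊕-comm f e) (++-swapˡ ((b , f) ⋆ q) ((a , e) ⋆ p) (p *ₚ q)) ⟩
    (a * b , e ⊕ f) ∷ ((a , e) ⋆ p ++ ((b , f) ⋆ q ++ p *ₚ q)) ∎
    where open ≃-Reasoning

  *ₚ-comm : ∀ p q → p *ₚ q ≃ q *ₚ p
  *ₚ-comm []      q = ≃-sym (≡⇒≃ (*ₚ-zeroʳ q))
  *ₚ-comm (t ∷ p) q = ≃-trans (++-cong ≃-refl (*ₚ-comm p q)) (≃-sym (*ₚ-∷ʳ q t p))

  *ₚ-congʳ : ∀ {p q} r → p ≃ q → p *ₚ r ≃ q *ₚ r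
  *ₚ-congʳ {p} {q} r p≃q = ≃-trans (*ₚ-comm p r) (≃-trans (*ₚ-congˡ r p≃q) (*ₚ-comm r q))

  *ₚ-distribˡ : ∀ p q r → p *ₚ (q ++ r) ≃ p *ₚ q ++ p *ₚ r
  *ₚ-distribˡ []      q r = ≃-refl
  *ₚ-distribˡ (t ∷ p) q r =
    ≃-trans (++-cong (≡⇒≃ (⋆-++ t q r)) (*ₚ-distribˡ p q r)) (++-interchange (t ⋆ q) (t ⋆ r) _ _)

  ⋆-⋆ : ∀ a e b f p → (a , e) ⋆ (b , f) ⋆ p ≃ (a * b , e ⊕ f) ⋆ p
  ⋆-⋆ a e b f []            = ≃-refl
  ⋆-⋆ a e b f ((c , g) ∷ p) = ∷-cong (sym (*-assoc a b c)) (≡.sym (⊕-assoc e f g)) (⋆-⋆ a e b f p)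

  ⋆-*ₚ : ∀ t p q → t ⋆ (p *ₚ q) ≃ (t ⋆ p) *ₚ q
  ⋆-*ₚ t       []            q = ≃-refl
  ⋆-*ₚ (a , e) ((b , f) ∷ p) q =
    ≃-trans (≡⇒≃ (⋆-++ (a , e) ((b , f) ⋆ q) (p *ₚ q))) (++-cong (⋆-⋆ a e b f q) (⋆-*ₚ (a , e) p q))

  *ₚ-assoc : ∀ p q r → (p *ₚ q) *ₚ r ≃ p *ₚ (q *ₚ r)
  *ₚ-assoc []      q r = ≃-refl
  *ₚ-assoc (t ∷ p) q r = begin
    (t ⋆ q ++ p *ₚ q) *ₚ r          ≡⟨ *ₚ-distribʳ (t ⋆ q) (p *ₚ q) r ⟩
    (t ⋆ q) *ₚ r ++ (p *ₚ q) *ₚ r   ≈⟨ ++-cong (≃-sym (⋆-*ₚ t q r)) (*ₚ-assoc p q r) ⟩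
    t ⋆ (q *ₚ r) ++ p *ₚ (q *ₚ r)   ∎
    where open ≃-Reasoning

  ⋆-congˡ : ∀ {a b e f} → a ≈ b → e ≡ f → ∀ p → (a , e) ⋆ p ≃ (b , f) ⋆ p
  ⋆-congˡ a≈b e≡f []            = ≃-refl
  ⋆-congˡ a≈b e≡f ((c , g) ∷ p) = ∷-cong (*-congʳ a≈b) (≡.cong (_⊕ g) e≡f) (⋆-congˡ a≈b e≡f p)

  unit⊕-⋆ : ∀ a i f p → (a , unit i ⊕ f) ⋆ p ≃ ((a , f) ∷ []) *ₚ (var i *ₚ p)
  unit⊕-⋆ a i f p = begin
    (a , unit i ⊕ f) ⋆ p
      ≈⟨ ⋆-congˡ (*-identityʳ a) (⊕-comm f (unit i)) p ⟨
    (a * 1# , f ⊕ unit i) ⋆ p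
      ≈⟨ ⋆-⋆ a f 1# (unit i) p ⟨
    (a , f) ⋆ (1# , unit i) ⋆ p
      ≡⟨ List.++-identityʳ _ ⟨
    ((a , f) ∷ []) *ₚ ((1# , unit i) ⋆ p)
      ≈⟨ *ₚ-congˡ ((a , f) ∷ []) (≡⇒≃ (List.++-identityʳ _)) ⟨
    ((a , f) ∷ []) *ₚ (var i *ₚ p) ∎
    where open ≃-Reasoning

  constant : Carrier → Pol
  constant b = (b , replicate n 0) ∷ []

  constant-*ₚ : ∀ b p → constant b *ₚ p ≃ b · p
  constant-*ₚ b p = ≃-trans (≡⇒≃ (List.++-identityʳ _)) (⋆-constant p)
    where
    ⋆-constant : ∀ p → (b , replicate n 0) ⋆ p ≃ b · p
    ⋆-constant []            = ≃-refl
    ⋆-constant ((a , e) ∷ p) = ∷-cong refl (⊕-identityˡ e) (⋆-constant p)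

  ·-identityˡ : ∀ p → 1# · p ≃ p
  ·-identityˡ p = ≈ₚ⇒≃ λ m → trans (coeff-· 1# p m) (*-identityˡ _)

  -1·p≃-p : ∀ p → (- 1#) · p ≃ -ₚ p
  -1·p≃-p p = ≈ₚ⇒≃ λ m → trans (coeff-· (- 1#) p m) (trans (-1*x≈-x _) (sym (coeff-neg p m)))

  -- Homogeneous components

  component-∷-≡ : ∀ {d} a e p → deg e ≡ d → component d ((a , e) ∷ p) ≡ (a , e) ∷ component d p
  component-∷-≡ {d} a e p = List.filter-accept (λ t → deg (proj₂ t) ℕ.≟ d) {a , e} {p}

  component-∷-≢ : ∀ {d} a e p → deg e ≢ d → component d ((a , e) ∷ p) ≡ component d p
  component-∷-≢ {d} a e p = List.filter-reject (λ t → deg (proj₂ t) ℕ.≟ d) {a , e} {p}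

  coeff-component-≡ : ∀ d p m → deg m ≡ d → coeff (component d p) m ≈ coeff p m
  coeff-component-≡ d []            m _ = refl
  coeff-component-≡ d ((a , e) ∷ p) m ∣m∣≡d with deg e ℕ.≟ d
  ... | yes ∣e∣≡d = begin
    coeff (component d ((a , e) ∷ p)) m  ≡⟨ ≡.cong (λ q → coeff q m) (component-∷-≡ a e p ∣e∣≡d) ⟩
    coeff ((a , e) ∷ component d p) m    ≈⟨ coeff-∷-congʳ a e m (coeff-component-≡ d p m ∣m∣≡d) ⟩
    coeff ((a , e) ∷ p) m                ∎
    where open ≈
  ... | no  ∣e∣≢d = begin
    coeff (component d ((a , e) ∷ p)) m
      ≡⟨ ≡.cong (λ q → coeff q m) (component-∷-≢ a e p ∣e∣≢d) ⟩
    coeff (component d p) m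
      ≈⟨ coeff-component-≡ d p m ∣m∣≡d ⟩
    coeff p m
      ≈⟨ +-identityˡ _ ⟨
    0# + coeff p m
      ≈⟨ +-congʳ (δ-≢ {e} {m} a λ e≡m → ∣e∣≢d (≡.trans (≡.cong deg e≡m) ∣m∣≡d)) ⟨
    δ e m a + coeff p m
      ≈⟨ coeff-∷ a e p m ⟨
    coeff ((a , e) ∷ p) m ∎
    where open ≈

  coeff-component-≢ : ∀ d p m → deg m ≢ d → coeff (component d p) m ≈ 0#
  coeff-component-≢ d []            m _ = refl
  coeff-component-≢ d ((a , e) ∷ p) m ∣m∣≢d with deg e ℕ.≟ d
  ... | yes ∣e∣≡d = begin
    coeff (component d ((a , e) ∷ p)) m  ≡⟨ ≡.cong (λ q → coeff q m) (component-∷-≡ a e p ∣e∣≡d) ⟩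
    coeff ((a , e) ∷ component d p) m    ≈⟨ coeff-∷ a e (component d p) m ⟩
    δ e m a + coeff (component d p) m    ≈⟨ +-cong (δ-≢ {e} {m} a e≢m) (coeff-component-≢ d p m ∣m∣≢d) ⟩
    0# + 0#                              ≈⟨ +-identityˡ 0# ⟩
    0#                                   ∎
    where
    open ≈
    e≢m : e ≢ m
    e≢m e≡m = ∣m∣≢d (≡.trans (≡.cong deg (≡.sym e≡m)) ∣e∣≡d)
  ... | no  ∣e∣≢d =
    trans (reflexive (≡.cong (λ q → coeff q m) (component-∷-≢ a e p ∣e∣≢d))) (coeff-component-≢ d p m ∣m∣≢d)

  ≃-by-degree : ∀ d {p q} → (∀ m → deg m ≡ d → coeff p m ≈ coeff q m) →
                (∀ m → deg m ≢ d → coeff p m ≈ coeff q m) → p ≃ q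
  ≃-by-degree d {p} {q} in-d out-d = ≈ₚ⇒≃ case
    where
    case : ∀ m → coeff p m ≈ coeff q m
    case m with deg m ℕ.≟ d
    ... | yes ∣m∣≡d = in-d m ∣m∣≡d
    ... | no  ∣m∣≢d = out-d m ∣m∣≢d

  component-cong : ∀ d {p q} → p ≃ q → component d p ≃ component d q
  component-cong d {p} {q} p≃q = ≃-by-degree d
    (λ m ∣m∣≡d → trans (coeff-component-≡ d p m ∣m∣≡d)
                  (trans (≃⇒≈ₚ p≃q m) (sym (coeff-component-≡ d q m ∣m∣≡d))))
    (λ m ∣m∣≢d → trans (coeff-component-≢ d p m ∣m∣≢d) (sym (coeff-component-≢ d q m ∣m∣≢d)))

  component-++ : ∀ d p q → component d (p ++ q) ≡ component d p ++ component d q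
  component-++ d = List.filter-++ (λ t → deg (proj₂ t) ℕ.≟ d)

  Homogeneous≃ : ℕ → Pol → Set ℓ
  Homogeneous≃ d p = p ≃ component d p

  homogeneous-by-coeff : ∀ d {p} → (∀ m → deg m ≢ d → coeff p m ≈ 0#) → Homogeneous≃ d p
  homogeneous-by-coeff d {p} vanish = ≃-by-degree d
    (λ m ∣m∣≡d → sym (coeff-component-≡ d p m ∣m∣≡d))
    (λ m ∣m∣≢d → trans (vanish m ∣m∣≢d) (sym (coeff-component-≢ d p m ∣m∣≢d)))

  homogeneous-coeff : ∀ {d p} → Homogeneous≃ d p → ∀ m → deg m ≢ d → coeff p m ≈ 0#
  homogeneous-coeff {d} {p} hom m ∣m∣≢d = trans (≃⇒≈ₚ hom m) (coeff-component-≢ d p m ∣m∣≢d)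

  component-homogeneous : ∀ d p → Homogeneous≃ d (component d p)
  component-homogeneous d p = homogeneous-by-coeff d (coeff-component-≢ d p)

  homogeneous-++ : ∀ {d p q} → Homogeneous≃ d p → Homogeneous≃ d q → Homogeneous≃ d (p ++ q)
  homogeneous-++ {d} {p} {q} hom-p hom-q = homogeneous-by-coeff d λ m ∣m∣≢d → begin
    coeff (p ++ q) m
      ≈⟨ coeff-++ p q m ⟩
    coeff p m + coeff q m
      ≈⟨ +-cong (homogeneous-coeff hom-p m ∣m∣≢d) (homogeneous-coeff hom-q m ∣m∣≢d) ⟩
    0# + 0#
      ≈⟨ +-identityˡ 0# ⟩
    0# ∎
    where open ≈

  homogeneous-neg : ∀ {d p} → Homogeneous≃ d p → Homogeneous≃ d (-ₚ p)
  homogeneous-neg {d} {p} hom = homogeneous-by-coeff d λ m ∣m∣≢d →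
    trans (coeff-neg p m) (trans (-‿cong (homogeneous-coeff hom m ∣m∣≢d)) +-AG.ε⁻¹≈ε)

  homogeneous-· : ∀ {d} b {p} → Homogeneous≃ d p → Homogeneous≃ d (b · p)
  homogeneous-· {d} b {p} hom = homogeneous-by-coeff d λ m ∣m∣≢d →
    trans (coeff-· b p m) (trans (*-congˡ (homogeneous-coeff hom m ∣m∣≢d)) (zeroʳ b))

  homogeneous-lincomb : ∀ {d r} (a : Fin r → Carrier) v → (∀ j → Homogeneous≃ d (v j)) →
                        Homogeneous≃ d (lincomb a v)
  homogeneous-lincomb {r = zero}  a v hom = ≃-refl
  homogeneous-lincomb {r = suc r} a v hom = homogeneous-++ (homogeneous-· (a Fin.zero) (hom Fin.zero))
    (homogeneous-lincomb (λ j → a (Fin.suc j)) (λ j → v (Fin.suc j)) (λ j → hom (Fin.suc j)))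

  component-homogeneous-≢ : ∀ {d e p} → Homogeneous≃ e p → d ≢ e → component d p ≃ []
  component-homogeneous-≢ {d} {e} {p} hom d≢e = ≃-by-degree d
    (λ m ∣m∣≡d → trans (coeff-component-≡ d p m ∣m∣≡d)
                  (homogeneous-coeff hom m λ ∣m∣≡e → d≢e (≡.trans (≡.sym ∣m∣≡d) ∣m∣≡e)))
    (λ m ∣m∣≢d → coeff-component-≢ d p m ∣m∣≢d)

  component-⋆ : ∀ d a e q → deg e ≤ d → component d ((a , e) ⋆ q) ≡ (a , e) ⋆ component (d ∸ deg e) q
  component-⋆ d a e []            _       = ≡.refl
  component-⋆ d a e ((b , f) ∷ q) ∣e∣≤d with deg f ℕ.≟ d ∸ deg e
  ... | yes ∣f∣≡d-∣e∣ = begin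
    component d ((a * b , e ⊕ f) ∷ (a , e) ⋆ q)
      ≡⟨ component-∷-≡ (a * b) (e ⊕ f) _ ∣e⊕f∣≡d ⟩
    (a * b , e ⊕ f) ∷ component d ((a , e) ⋆ q)
      ≡⟨ ≡.cong (_ ∷_) (component-⋆ d a e q ∣e∣≤d) ⟩
    (a , e) ⋆ ((b , f) ∷ component (d ∸ deg e) q)
      ≡⟨ ≡.cong ((a , e) ⋆_) (component-∷-≡ b f q ∣f∣≡d-∣e∣) ⟨
    (a , e) ⋆ component (d ∸ deg e) ((b , f) ∷ q) ∎
    where
    open ≡.≡-Reasoning
    ∣e⊕f∣≡d : deg (e ⊕ f) ≡ d
    ∣e⊕f∣≡d =
      ≡.trans (sum-⊕ e f) (≡.trans (≡.cong (deg e ℕ.+_) ∣f∣≡d-∣e∣) (ℕ.m+[n∸m]≡n ∣e∣≤d))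
  ... | no ∣f∣≢d-∣e∣ = begin
    component d ((a * b , e ⊕ f) ∷ (a , e) ⋆ q)
      ≡⟨ component-∷-≢ (a * b) (e ⊕ f) _ ∣e⊕f∣≢d ⟩
    component d ((a , e) ⋆ q)
      ≡⟨ component-⋆ d a e q ∣e∣≤d ⟩
    (a , e) ⋆ component (d ∸ deg e) q
      ≡⟨ ≡.cong ((a , e) ⋆_) (component-∷-≢ b f q ∣f∣≢d-∣e∣) ⟨
    (a , e) ⋆ component (d ∸ deg e) ((b , f) ∷ q) ∎
    where
    open ≡.≡-Reasoning
    ∣e⊕f∣≢d : deg (e ⊕ f) ≢ d
    ∣e⊕f∣≢d ∣e⊕f∣≡d = ∣f∣≢d-∣e∣ (≡.trans (≡.sym (ℕ.m+n∸m≡n (deg e) (deg f)))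
                                         (≡.cong (_∸ deg e) (≡.trans (≡.sym (sum-⊕ e f)) ∣e⊕f∣≡d)))

  component-⋆-> : ∀ d a e q → ¬ deg e ≤ d → component d ((a , e) ⋆ q) ≡ []
  component-⋆-> d a e []            _       = ≡.refl
  component-⋆-> d a e ((b , f) ∷ q) ∣e∣≰d =
    ≡.trans (component-∷-≢ (a * b) (e ⊕ f) _ ∣e⊕f∣≢d) (component-⋆-> d a e q ∣e∣≰d)
    where
    ∣e⊕f∣≢d : deg (e ⊕ f) ≢ d
    ∣e⊕f∣≢d ∣e⊕f∣≡d =
      ∣e∣≰d (≡.subst (deg e ≤_) (≡.trans (≡.sym (sum-⊕ e f)) ∣e⊕f∣≡d) (ℕ.m≤m+n (deg e) (deg f)))

  component-⋆-homogeneous : ∀ e d a f {q} → Homogeneous≃ e q →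
                            component (e ℕ.+ d) ((a , f) ⋆ q) ≃ component d ((a , f) ∷ []) *ₚ q
  component-⋆-homogeneous e d a f {q} hom with deg f ℕ.≟ d
  ... | yes ∣f∣≡d = begin
    component (e ℕ.+ d) ((a , f) ⋆ q)
      ≡⟨ component-⋆ (e ℕ.+ d) a f q ∣f∣≤e+d ⟩
    (a , f) ⋆ component (e ℕ.+ d ∸ deg f) q
      ≡⟨ ≡.cong (λ x → (a , f) ⋆ component (e ℕ.+ d ∸ x) q) ∣f∣≡d ⟩
    (a , f) ⋆ component (e ℕ.+ d ∸ d) q
      ≡⟨ ≡.cong (λ x → (a , f) ⋆ component x q) (ℕ.m+n∸n≡m e d) ⟩
    (a , f) ⋆ component e q
      ≈⟨ ⋆-congʳ (a , f) (≃-sym hom) ⟩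
    (a , f) ⋆ q
      ≡⟨ List.++-identityʳ _ ⟨
    ((a , f) ∷ []) *ₚ q
      ≡⟨ ≡.cong (_*ₚ q) (component-∷-≡ a f [] ∣f∣≡d) ⟨
    component d ((a , f) ∷ []) *ₚ q ∎
    where
    open ≃-Reasoning
    ∣f∣≤e+d : deg f ≤ e ℕ.+ d
    ∣f∣≤e+d = ≡.subst (_≤ e ℕ.+ d) (≡.sym ∣f∣≡d) (ℕ.m≤n+m d e)
  ... | no ∣f∣≢d = ≃-trans vanishing (≡⇒≃ (≡.cong (_*ₚ q) (≡.sym (component-∷-≢ a f [] ∣f∣≢d))))
    where
    vanishing : component (e ℕ.+ d) ((a , f) ⋆ q) ≃ []
    vanishing with deg f ℕ.≤? e ℕ.+ d
    ... | no ∣f∣≰e+d = ≡⇒≃ (component-⋆-> (e ℕ.+ d) a f q ∣f∣≰e+d)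
    ... | yes ∣f∣≤e+d = ≃-trans (≡⇒≃ (component-⋆ (e ℕ.+ d) a f q ∣f∣≤e+d))
                                (⋆-congʳ (a , f) (component-homogeneous-≢ hom e+d-∣f∣≢e))
      where
      e+d-∣f∣≢e : e ℕ.+ d ∸ deg f ≢ e
      e+d-∣f∣≢e e+d-∣f∣≡e = ∣f∣≢d (m+n∸o≡m⇒o≡n e d ∣f∣≤e+d e+d-∣f∣≡e)

  component-*ₚ-homogeneousʳ : ∀ e d p {q} → Homogeneous≃ e q →
                               component (e ℕ.+ d) (p *ₚ q) ≃ component d p *ₚ q
  component-*ₚ-homogeneousʳ e d []            hom = ≃-refl
  component-*ₚ-homogeneousʳ e d ((a , f) ∷ p) {q} hom = begin
    component (e ℕ.+ d) ((a , f) ⋆ q ++ p *ₚ q)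
      ≡⟨ component-++ (e ℕ.+ d) ((a , f) ⋆ q) (p *ₚ q) ⟩
    component (e ℕ.+ d) ((a , f) ⋆ q) ++ component (e ℕ.+ d) (p *ₚ q)
      ≈⟨ ++-cong (component-⋆-homogeneous e d a f hom) (component-*ₚ-homogeneousʳ e d p hom) ⟩
    component d ((a , f) ∷ []) *ₚ q ++ component d p *ₚ q
      ≡⟨ *ₚ-distribʳ (component d ((a , f) ∷ [])) (component d p) q ⟨
    (component d ((a , f) ∷ []) ++ component d p) *ₚ q
      ≡⟨ ≡.cong (_*ₚ q) (component-++ d ((a , f) ∷ []) p) ⟨
    component d ((a , f) ∷ p) *ₚ q ∎
    where open ≃-Reasoning

  component-var-*ₚ : ∀ d i p → component (suc d) (var i *ₚ p) ≡ var i *ₚ component d p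
  component-var-*ₚ d i p = begin
    component (suc d) ((1# , unit i) ⋆ p ++ [])
      ≡⟨ ≡.cong (component (suc d)) (List.++-identityʳ ((1# , unit i) ⋆ p)) ⟩
    component (suc d) ((1# , unit i) ⋆ p)
      ≡⟨ component-⋆ (suc d) 1# (unit i) p ∣unit∣≤1+d ⟩
    (1# , unit i) ⋆ component (suc d ∸ deg (unit i)) p
      ≡⟨ ≡.cong (λ x → (1# , unit i) ⋆ component (suc d ∸ x) p) (sum-unit i) ⟩
    (1# , unit i) ⋆ component d p
      ≡⟨ List.++-identityʳ ((1# , unit i) ⋆ component d p) ⟨
    (1# , unit i) ⋆ component d p ++ [] ∎
    where
    open ≡.≡-Reasoning
    ∣unit∣≤1+d : deg (unit i) ≤ suc d
    ∣unit∣≤1+d = ≡.subst (_≤ suc d) (≡.sym (sum-unit i)) (s≤s z≤n)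

  component-zero-var-*ₚ : ∀ i p → component 0 (var i *ₚ p) ≡ []
  component-zero-var-*ₚ i p = ≡.trans (≡.cong (component 0) (List.++-identityʳ ((1# , unit i) ⋆ p)))
    (component-⋆-> 0 1# (unit i) p λ ∣unit∣≤0 → ℕ.1+n≰n (≡.subst (_≤ 0) (sum-unit i) ∣unit∣≤0))

  -- Ideals generated by a set

  infix 4 _∈⟨_⟩

  record _∈⟨_⟩ (p : Pol) (G : Pol → Set (c ⊔ ℓ)) : Set (c ⊔ ℓ) where
    constructor generated
    field generation : Generated G p
  open _∈⟨_⟩ public

  module _ {G : Pol → Set (c ⊔ ℓ)} where

    generated-resp : ∀ {p q} → p ≃ q → p ∈⟨ G ⟩ → q ∈⟨ G ⟩
    generated-resp p≃q (generated (r , a , g , g∈G , p≈Σ)) =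
      generated (r , a , g , g∈G , λ m → trans (sym (≃⇒≈ₚ p≃q m)) (p≈Σ m))

    generated-[] : [] ∈⟨ G ⟩
    generated-[] = generated (0 , (λ ()) , (λ ()) , (λ ()) , λ _ → refl)

    generated-∷ : ∀ f {g p} → G g → p ∈⟨ G ⟩ → f *ₚ g ++ p ∈⟨ G ⟩
    generated-∷ f {g} {p} g∈G (generated (r , a , gs , gs∈G , p≈Σ)) = generated
      ( suc r
      , (λ { Fin.zero → f ; (Fin.suc j) → a j })
      , (λ { Fin.zero → g ; (Fin.suc j) → gs j })
      , (λ { Fin.zero → g∈G ; (Fin.suc j) → gs∈G j })
      , λ m → coeff-++-congʳ (f *ₚ g) {p} m (p≈Σ m))

    second-summand : ∀ {p} q {r} → p ≈ₚ (q ++ r) → Pol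
    second-summand q {r} _ = r

    -- The sum Σⱼ aⱼ gⱼ of Generated is local to its definition and cannot be named here:
    -- second-summand reads its tail off the type of the witness, and the recursion is on
    -- the number of summands.
    generated-elim : ∀ {q} (Q : Pol → Set q) → (∀ {x y} → x ≃ y → Q x → Q y) → Q [] →
                     (∀ f {g x} → G g → Q x → Q (f *ₚ g ++ x)) → ∀ {p} → p ∈⟨ G ⟩ → Q p
    generated-elim Q resp nil cons (generated x) = by-length _ x ≡.refl
      where
      by-length : ∀ r {p} (x : Generated G p) → proj₁ x ≡ r → Q p
      by-length _ (zero , _ , _ , _ , p≈[]) _ = resp (≃-sym (≈ₚ⇒≃ p≈[])) nil
      by-length (suc r) {p} (suc r' , a , g , g∈G , p≈Σ) 1+r'≡1+r =
        resp {a Fin.zero *ₚ g Fin.zero ++ rest} {p} (≃-sym (≈ₚ⇒≃ p≈Σ))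
          (cons (a Fin.zero) (g∈G Fin.zero)
            (by-length r {rest} (r' , (λ j → a (Fin.suc j)) , (λ j → g (Fin.suc j)) ,
                                  (λ j → g∈G (Fin.suc j)) , λ _ → refl) (ℕ.suc-injective 1+r'≡1+r)))
        where
        rest : Pol
        rest = second-summand {p} (a Fin.zero *ₚ g Fin.zero) p≈Σ

    generated-++ : ∀ {p q} → p ∈⟨ G ⟩ → q ∈⟨ G ⟩ → p ++ q ∈⟨ G ⟩
    generated-++ {q = q} = generated-elim (λ x → q ∈⟨ G ⟩ → x ++ q ∈⟨ G ⟩)
      (λ x≃y x++q∈ q∈ → generated-resp (++-cong x≃y ≃-refl) (x++q∈ q∈))
      (λ q∈ → q∈)
      (λ f {g} {x} g∈G x++q∈ q∈ → generated-resp (≡⇒≃ (≡.sym (List.++-assoc (f *ₚ g) x q)))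
                                     (generated-∷ f g∈G (x++q∈ q∈)))

    generated-*ₚ : ∀ f {g} → G g → f *ₚ g ∈⟨ G ⟩
    generated-*ₚ f {g} g∈G =
      generated-resp (≡⇒≃ (List.++-identityʳ (f *ₚ g))) (generated-∷ f g∈G generated-[])

    generated-*ₚˡ : ∀ f {p} → p ∈⟨ G ⟩ → f *ₚ p ∈⟨ G ⟩
    generated-*ₚˡ f = generated-elim (λ x → f *ₚ x ∈⟨ G ⟩)
      (λ x≃y → generated-resp (*ₚ-congˡ f x≃y))
      (generated-resp (≡⇒≃ (≡.sym (*ₚ-zeroʳ f))) generated-[])
      (λ h {g} {x} g∈G f*x∈ →
        generated-resp (f*[h*g++x] h g x) (generated-++ (generated-*ₚ (f *ₚ h) g∈G) f*x∈))
      where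
      f*[h*g++x] : ∀ h g x → (f *ₚ h) *ₚ g ++ f *ₚ x ≃ f *ₚ (h *ₚ g ++ x)
      f*[h*g++x] h g x =
        ≃-sym (≃-trans (*ₚ-distribˡ f (h *ₚ g) x) (++-cong (≃-sym (*ₚ-assoc f h g)) ≃-refl))

    generated-∈ : ∀ {g} → G g → g ∈⟨ G ⟩
    generated-∈ {g} g∈G =
      generated-resp (≃-trans (constant-*ₚ 1# g) (·-identityˡ g)) (generated-*ₚ (constant 1#) g∈G)

    generated-· : ∀ b {p} → p ∈⟨ G ⟩ → b · p ∈⟨ G ⟩
    generated-· b {p} p∈ = generated-resp (constant-*ₚ b p) (generated-*ₚˡ (constant b) p∈)

    generated-lincomb : ∀ {r} (a : Fin r → Carrier) v → (∀ j → v j ∈⟨ G ⟩) → lincomb a v ∈⟨ G ⟩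
    generated-lincomb {zero}  a v v∈ = generated-[]
    generated-lincomb {suc r} a v v∈ = generated-++ (generated-· (a Fin.zero) (v∈ Fin.zero))
      (generated-lincomb (λ j → a (Fin.suc j)) (λ j → v (Fin.suc j)) (λ j → v∈ (Fin.suc j)))

    generated-component : (∀ {g} → G g → ∀ d → component d g ∈⟨ G ⟩) →
                          ∀ {p} → p ∈⟨ G ⟩ → ∀ d → component d p ∈⟨ G ⟩
    generated-component component∈ = generated-elim (λ x → ∀ d → component d x ∈⟨ G ⟩)
      (λ x≃y x∈ d → generated-resp (component-cong d x≃y) (x∈ d))
      (λ d → generated-[])
      (λ f {g} {x} g∈G x∈ d → generated-resp (≡⇒≃ (≡.sym (component-++ d (f *ₚ g) x)))
                                (generated-++ (product∈ f g∈G d) (x∈ d)))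
      where
      product∈ : ∀ f {g} → G g → ∀ d → component d (f *ₚ g) ∈⟨ G ⟩
      product∈ []            g∈G d = generated-[]
      product∈ ((a , e) ∷ f) {g} g∈G d =
        generated-resp (≡⇒≃ (≡.sym (component-++ d ((a , e) ⋆ g) (f *ₚ g)))) (generated-++ term∈ (product∈ f g∈G d))
        where
        term∈ : component d ((a , e) ⋆ g) ∈⟨ G ⟩
        term∈ with deg e ℕ.≤? d
        ... | no  ∣e∣≰d = generated-resp (≃-sym (≡⇒≃ (component-⋆-> d a e g ∣e∣≰d))) generated-[]
        ... | yes ∣e∣≤d = generated-resp
          (≃-sym (≃-trans (≡⇒≃ (component-⋆ d a e g ∣e∣≤d)) (≡⇒≃ (≡.sym (List.++-identityʳ _)))))
          (generated-*ₚˡ ((a , e) ∷ []) (component∈ g∈G (d ∸ deg e)))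

  generated-mono : ∀ {G G' : Pol → Set (c ⊔ ℓ)} → (∀ {g} → G g → G' g) →
                   ∀ {p} → p ∈⟨ G ⟩ → p ∈⟨ G' ⟩
  generated-mono G⊆G' (generated (r , a , g , g∈G , p≈Σ)) =
    generated (r , a , g , (λ j → G⊆G' (g∈G j)) , p≈Σ)

  component-suc-*ₚ-∈⟨var*⟩ : ∀ {G} d p {q} → (∀ i → G (var i *ₚ q)) →
                             component (suc d) p *ₚ q ∈⟨ G ⟩
  component-suc-*ₚ-∈⟨var*⟩ d []            var*q∈G = generated-[]
  component-suc-*ₚ-∈⟨var*⟩ d ((a , e) ∷ p) {q} var*q∈G with deg e ℕ.≟ suc d
  ... | no  ∣e∣≢1+d = ≡.subst (λ x → x *ₚ q ∈⟨ _ ⟩) (≡.sym (component-∷-≢ a e p ∣e∣≢1+d))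
                        (component-suc-*ₚ-∈⟨var*⟩ d p var*q∈G)
  ... | yes ∣e∣≡1+d with 1≤sum⇒unit⊕ e (≡.subst (1 ≤_) (≡.sym ∣e∣≡1+d) (s≤s z≤n))
  ...   | i , f , ≡.refl =
    ≡.subst (λ x → x *ₚ q ∈⟨ _ ⟩) (≡.sym (component-∷-≡ a (unit i ⊕ f) p ∣e∣≡1+d))
      (generated-++ (generated-resp (≃-sym (unit⊕-⋆ a i f q)) (generated-*ₚ ((a , f) ∷ []) (var*q∈G i)))
                    (component-suc-*ₚ-∈⟨var*⟩ d p var*q∈G))

  module _ (I : Ideal) where

    ideal-resp : ∀ {p q} → p ≃ q → _∈I I p → _∈I I q
    ideal-resp p≃q = resp I (≃⇒≈ₚ p≃q)

    ideal-· : ∀ b {p} → _∈I I p → _∈I I (b · p)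
    ideal-· b {p} p∈I = ideal-resp (constant-*ₚ b p) (*-closed I (constant b) p∈I)

    ideal-neg : ∀ {p} → _∈I I p → _∈I I (-ₚ p)
    ideal-neg {p} p∈I = ideal-resp (-1·p≃-p p) (ideal-· (- 1#) p∈I)

    ideal-lincomb : ∀ {r} (a : Fin r → Carrier) v → (∀ j → _∈I I (v j)) → _∈I I (lincomb a v)
    ideal-lincomb {zero}  a v v∈I = zero∈ I
    ideal-lincomb {suc r} a v v∈I = +-closed I (ideal-· (a Fin.zero) (v∈I Fin.zero))
      (ideal-lincomb (λ j → a (Fin.suc j)) (λ j → v (Fin.suc j)) (λ j → v∈I (Fin.suc j)))

    ideal-++-cancelˡ : ∀ {p q r} → p ≃ q ++ r → _∈I I p → _∈I I q → _∈I I r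
    ideal-++-cancelˡ p≃q++r p∈I q∈I =
      ideal-resp (≃-sym (p≃q++r⇒r≃p-q p≃q++r)) (+-closed I p∈I (ideal-neg q∈I))

    generated⊆ideal : ∀ {G} → (∀ {g} → G g → _∈I I g) → ∀ {p} → p ∈⟨ G ⟩ → _∈I I p
    generated⊆ideal {G} G⊆I = generated-elim {G} (_∈I I) ideal-resp (zero∈ I)
      (λ f g∈G x∈I → +-closed I (*-closed I f (G⊆I g∈G)) x∈I)

  -- Minimal generators modulo a regular linear form

  m·_ : (Pol → Set (c ⊔ ℓ)) → Pol → Set (c ⊔ ℓ)
  (m· V) q = ∃[ i ] ∃[ f ] (V f × q ≈ₚ (var i *ₚ f))

  module RegularLinearForm (I : Ideal) (I-homogeneous : IsHomogeneous I)
                           (w : Pol) (w-linear : Homogeneous 1 w) (d : ℕ)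
                           (w-regular : ∀ f → Homogeneous (suc d) f → _∈I I (w *ₚ f) → _∈I I f) where

    k : ℕ
    k = suc (suc d)

    -- Generating sets of I + (w), m I and m (I + (w)), as in _∈I+⟨_⟩_, _∈mI_ and _∈m[I+⟨_⟩]_.
    J mI mJ : Pol → Set (c ⊔ ℓ)
    J q  = _∈I I q ⊎ Lift c (q ≈ₚ w)
    mI   = m· (_∈I I)
    mJ   = m· (λ f → f ∈I+⟨ w ⟩ I)

    infix 4 _∈_+⟨w⟩

    record _∈_+⟨w⟩ (p : Pol) (V : Pol → Set (c ⊔ ℓ)) : Set (c ⊔ ℓ) where
      constructor decomposition
      field
        summand   : Pol
        cofactor  : Pol
        summand∈V : V summand
        p≃        : p ≃ summand ++ cofactor *ₚ w

    module _ {V : Pol → Set (c ⊔ ℓ)} where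

      +⟨w⟩-resp : ∀ {p q} → p ≃ q → p ∈ V +⟨w⟩ → q ∈ V +⟨w⟩
      +⟨w⟩-resp p≃q (decomposition s g s∈V p≃) = decomposition s g s∈V (≃-trans (≃-sym p≃q) p≃)

      +⟨w⟩-++ : (∀ {x y} → V x → V y → V (x ++ y)) →
                ∀ {p q} → p ∈ V +⟨w⟩ → q ∈ V +⟨w⟩ → p ++ q ∈ V +⟨w⟩
      +⟨w⟩-++ V-++ {p} {q} (decomposition s g s∈V p≃) (decomposition t h t∈V q≃) =
        decomposition (s ++ t) (g ++ h) (V-++ s∈V t∈V) (begin
          p ++ q                              ≈⟨ ++-cong p≃ q≃ ⟩
          (s ++ g *ₚ w) ++ (t ++ h *ₚ w)      ≈⟨ ++-interchange s (g *ₚ w) t (h *ₚ w) ⟩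
          (s ++ t) ++ (g *ₚ w ++ h *ₚ w)      ≡⟨ ≡.cong ((s ++ t) ++_) (*ₚ-distribʳ g h w) ⟨
          (s ++ t) ++ (g ++ h) *ₚ w           ∎)
        where open ≃-Reasoning

    w-linear≃ : Homogeneous≃ 1 w
    w-linear≃ = ≈ₚ⇒≃ w-linear

    I⊆J : ∀ {p} → _∈I I p → p ∈⟨ J ⟩
    I⊆J p∈I = generated-∈ (inj₁ p∈I)

    w∈J : w ∈⟨ J ⟩
    w∈J = generated-∈ (inj₂ (lift λ _ → refl))

    mI⊆I : ∀ {p} → p ∈⟨ mI ⟩ → _∈I I p
    mI⊆I = generated⊆ideal I λ (i , f , f∈I , g≈) → resp I (λ m → sym (g≈ m)) (*-closed I (var i) f∈I)

    mI⊆mJ : ∀ {p} → p ∈⟨ mI ⟩ → p ∈⟨ mJ ⟩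
    mI⊆mJ = generated-mono λ (i , f , f∈I , g≈) → i , f , generation (I⊆J f∈I) , g≈

    J-decomposition : ∀ {p} → p ∈⟨ J ⟩ → p ∈ _∈I I +⟨w⟩
    J-decomposition = generated-elim (_∈ _∈I I +⟨w⟩) +⟨w⟩-resp (decomposition [] [] (zero∈ I) ≃-refl)
      λ f g∈J x∈ → +⟨w⟩-++ (+-closed I) (multiple f g∈J) x∈
      where
      multiple : ∀ f {g} → J g → f *ₚ g ∈ _∈I I +⟨w⟩
      multiple f {g} (inj₁ g∈I)        = decomposition (f *ₚ g) [] (*-closed I f g∈I)
                                           (≡⇒≃ (≡.sym (List.++-identityʳ (f *ₚ g))))
      multiple f     (inj₂ (lift g≈w)) = decomposition [] f (zero∈ I) (*ₚ-congˡ f (≈ₚ⇒≃ g≈w))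

    mJ-decomposition : ∀ {p} → p ∈⟨ mJ ⟩ → p ∈ _∈⟨ mI ⟩ +⟨w⟩
    mJ-decomposition =
      generated-elim (_∈ _∈⟨ mI ⟩ +⟨w⟩) +⟨w⟩-resp (decomposition [] [] generated-[] ≃-refl)
      λ f g∈mJ x∈ → +⟨w⟩-++ generated-++ (multiple f g∈mJ) x∈
      where
      multiple : ∀ f {g} → mJ g → f *ₚ g ∈ _∈⟨ mI ⟩ +⟨w⟩
      multiple f {g} (i , q , q∈J , g≈) with J-decomposition (generated q∈J)
      ... | decomposition s h s∈I q≃ =
        decomposition (f *ₚ (var i *ₚ s)) (f *ₚ (var i *ₚ h))
          (generated-*ₚ f (i , s , s∈I , λ _ → refl)) (begin
          f *ₚ g
            ≈⟨ *ₚ-congˡ f (≈ₚ⇒≃ g≈) ⟩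
          f *ₚ (var i *ₚ q)
            ≈⟨ *ₚ-congˡ f (*ₚ-congˡ (var i) q≃) ⟩
          f *ₚ (var i *ₚ (s ++ h *ₚ w))
            ≈⟨ *ₚ-congˡ f (*ₚ-distribˡ (var i) s (h *ₚ w)) ⟩
          f *ₚ (var i *ₚ s ++ var i *ₚ (h *ₚ w))
            ≈⟨ *ₚ-distribˡ f (var i *ₚ s) (var i *ₚ (h *ₚ w)) ⟩
          f *ₚ (var i *ₚ s) ++ f *ₚ (var i *ₚ (h *ₚ w))
            ≈⟨ ++-cong (≃-refl {f *ₚ (var i *ₚ s)}) f[ih]w ⟩
          f *ₚ (var i *ₚ s) ++ (f *ₚ (var i *ₚ h)) *ₚ w ∎)
        where
        open ≃-Reasoning
        f[ih]w : f *ₚ (var i *ₚ (h *ₚ w)) ≃ (f *ₚ (var i *ₚ h)) *ₚ w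
        f[ih]w = ≃-sym (≃-trans (*ₚ-assoc f (var i *ₚ h) w) (*ₚ-congˡ f (*ₚ-assoc (var i) h w)))

    mI-component : ∀ {p} → p ∈⟨ mI ⟩ → ∀ e → component e p ∈⟨ mI ⟩
    mI-component = generated-component (λ {g} → generator-component {g})
      where
      generator-component : ∀ {g} → mI g → ∀ e → component e g ∈⟨ mI ⟩
      generator-component {g} (i , f , f∈I , g≈) e =
        generated-resp (component-cong e (≃-sym (≈ₚ⇒≃ {g} {var i *ₚ f} g≈))) (var*f-component e)
        where
        var*f-component : ∀ e → component e (var i *ₚ f) ∈⟨ mI ⟩
        var*f-component zero    = generated-resp (≡⇒≃ (≡.sym (component-zero-var-*ₚ i f))) generated-[]
        var*f-component (suc e) = generated-resp (≡⇒≃ (≡.sym (component-var-*ₚ e i f)))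
          (generated-∈ (i , component e f , I-homogeneous e f f∈I , λ _ → refl))

    *w∈mI : ∀ {p} → _∈I I p → p *ₚ w ∈⟨ mI ⟩
    *w∈mI {p} p∈I = generated-resp (≃-trans (*ₚ-congʳ p (≃-sym w-linear≃)) (*ₚ-comm w p))
      (component-suc-*ₚ-∈⟨var*⟩ 0 w (λ i → i , p , p∈I , λ _ → refl))

    component*w∈mJ : ∀ h → component (suc d) h *ₚ w ∈⟨ mJ ⟩
    component*w∈mJ h = component-suc-*ₚ-∈⟨var*⟩ d h (λ i → i , w , generation w∈J , λ _ → refl)

    homogeneous-decomposition : ∀ {p s h} → Homogeneous≃ k p → p ≃ s ++ h *ₚ w →
                                p ≃ component k s ++ component (suc d) h *ₚ w
    homogeneous-decomposition {p} {s} {h} p-hom p≃ = begin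
      p                                                  ≈⟨ p-hom ⟩
      component k p                                      ≈⟨ component-cong k p≃ ⟩
      component k (s ++ h *ₚ w)                          ≡⟨ component-++ k s (h *ₚ w) ⟩
      component k s ++ component k (h *ₚ w)              ≈⟨ ++-cong (≃-refl {component k s})
                                                              (component-*ₚ-homogeneousʳ 1 (suc d) h w-linear≃) ⟩
      component k s ++ component (suc d) h *ₚ w          ∎
      where open ≃-Reasoning

    I∩mJ⊆mI : ∀ {p} → _∈I I p → Homogeneous≃ k p → p ∈⟨ mJ ⟩ → p ∈⟨ mI ⟩
    I∩mJ⊆mI {p} p∈I p-hom p∈mJ with mJ-decomposition p∈mJ
    ... | decomposition s h s∈mI p≃ =
      generated-resp (≃-sym p≃s'+h'w) (generated-++ s'∈mI (*w∈mI h'∈I))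
      where
      p≃s'+h'w : p ≃ component k s ++ component (suc d) h *ₚ w
      p≃s'+h'w = homogeneous-decomposition {s = s} {h} p-hom p≃
      s'∈mI : component k s ∈⟨ mI ⟩
      s'∈mI = mI-component s∈mI k
      h'∈I : _∈I I (component (suc d) h)
      h'∈I = w-regular (component (suc d) h) (≃⇒≈ₚ (component-homogeneous (suc d) h))
        (ideal-resp I (*ₚ-comm (component (suc d) h) w) (ideal-++-cancelˡ I p≃s'+h'w p∈I (mI⊆I s'∈mI)))

    record Splitting (p : Pol) : Set (c ⊔ ℓ) where
      constructor splitting
      field
        u y     : Pol
        u∈I     : _∈I I u
        u-hom   : Homogeneous≃ k u
        y∈mJ    : y ∈⟨ mJ ⟩
        p≃u++y  : p ≃ u ++ y

    J-splitting : ∀ {p} → p ∈⟨ J ⟩ → Homogeneous≃ k p → Splitting p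
    J-splitting p∈J p-hom with J-decomposition p∈J
    ... | decomposition s h s∈I p≃ =
      splitting (component k s) (component (suc d) h *ₚ w) (I-homogeneous k s s∈I) (component-homogeneous k s)
                (component*w∈mJ h) (homogeneous-decomposition {s = s} {h} p-hom p≃)

    μ-I⇒μ-I+⟨w⟩ : ∀ r → μ[ k ] I ≡ r → μ[ k ]I+⟨ w ⟩ I ≡ r
    μ-I⇒μ-I+⟨w⟩ r (v , v∈I , independent , spanning) = v , v∈J , independentJ , spanningJ
      where
      v∈J : ∀ j → (v j ∈I+⟨ w ⟩ I) × Homogeneous k (v j)
      v∈J j = generation (I⊆J (proj₁ (v∈I j))) , proj₂ (v∈I j)

      independentJ : ∀ a → lincomb a v ∈m[I+⟨ w ⟩] I → ∀ j → a j ≈ 0#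
      independentJ a Σav∈mJ = independent a (generation (I∩mJ⊆mI
        (ideal-lincomb I a v (λ j → proj₁ (v∈I j)))
        (homogeneous-lincomb a v (λ j → ≈ₚ⇒≃ {v j} (proj₂ (v∈I j))))
        (generated Σav∈mJ)))

      spanningJ : ∀ p → p ∈I+⟨ w ⟩ I → Homogeneous k p → ∃[ a ] ((p -ₚ lincomb a v) ∈m[I+⟨ w ⟩] I)
      spanningJ p p∈J p-hom with J-splitting (generated p∈J) (≈ₚ⇒≃ {p} p-hom)
      ... | splitting u y u∈I u-hom y∈mJ p≃u++y with spanning u u∈I (≃⇒≈ₚ u-hom)
      ... | a , u-Σav∈mI =
        a , generation (generated-resp p-Σav≃ (generated-++ (mI⊆mJ (generated u-Σav∈mI)) y∈mJ))
        where
        p-Σav≃ : (u -ₚ lincomb a v) ++ y ≃ p -ₚ lincomb a v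
        p-Σav≃ =
          ≃-sym (≃-trans (++-cong p≃u++y (≃-refl { -ₚ lincomb a v})) (++-swapʳ u y (-ₚ lincomb a v)))

    μ-I+⟨w⟩⇒μ-I : ∀ r → μ[ k ]I+⟨ w ⟩ I ≡ r → μ[ k ] I ≡ r
    μ-I+⟨w⟩⇒μ-I r (v , v∈J , independent , spanning) = u , u∈ , independentI , spanningI
      where
      module V (j : Fin r) =
        Splitting (J-splitting (generated (proj₁ (v∈J j))) (≈ₚ⇒≃ {v j} (proj₂ (v∈J j))))
      u y : Fin r → Pol
      u = V.u
      y = V.y

      u∈ : ∀ j → _∈I I (u j) × Homogeneous k (u j)
      u∈ j = V.u∈I j , ≃⇒≈ₚ (V.u-hom j)

      Σav≃Σau++Σay : ∀ a → lincomb a v ≃ lincomb a u ++ lincomb a y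
      Σav≃Σau++Σay a = ≃-trans (lincomb-cong a V.p≃u++y) (lincomb-++ a u y)

      Σay∈mJ : ∀ a → lincomb a y ∈⟨ mJ ⟩
      Σay∈mJ a = generated-lincomb a y V.y∈mJ

      independentI : ∀ a → lincomb a u ∈mI I → ∀ j → a j ≈ 0#
      independentI a Σau∈mI = independent a (generation
        (generated-resp (≃-sym (Σav≃Σau++Σay a)) (generated-++ (mI⊆mJ (generated Σau∈mI)) (Σay∈mJ a))))

      spanningI : ∀ p → _∈I I p → Homogeneous k p → ∃[ a ] ((p -ₚ lincomb a u) ∈mI I)
      spanningI p p∈I p-hom with spanning p (generation (I⊆J p∈I)) p-hom
      ... | a , p-Σav∈mJ = a , generation (I∩mJ⊆mI p-Σau∈I p-Σau-hom p-Σau∈mJ)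
        where
        p-Σau∈I : _∈I I (p -ₚ lincomb a u)
        p-Σau∈I = +-closed I p∈I (ideal-neg I (ideal-lincomb I a u V.u∈I))
        p-Σau-hom : Homogeneous≃ k (p -ₚ lincomb a u)
        p-Σau-hom = homogeneous-++ (≈ₚ⇒≃ {p} p-hom) (homogeneous-neg (homogeneous-lincomb a u V.u-hom))
        p-Σau∈mJ : p -ₚ lincomb a u ∈⟨ mJ ⟩
        p-Σau∈mJ = generated-resp (≃-sym (q≃s++t⇒p-s≃[p-q]++t p (Σav≃Σau++Σay a)))
                     (generated-++ (generated p-Σav∈mJ) (Σay∈mJ a))

lemma2p2 : ∀ {c ℓ : Level} (K : Field c ℓ) (n : ℕ) →
    let open Poly K n in
    (I : Ideal) → IsHomogeneous I →
    (w : Pol) → Homogeneous 1 w →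
    (k : ℕ) → 2 ≤ k →
    (∀ f → Homogeneous (k ∸ 1) f → _∈I I (w *ₚ f) → _∈I I f) →
    ∀ d → (μ[ k ] I ≡ d) ⇔ (μ[ k ]I+⟨ w ⟩ I ≡ d)
lemma2p2 K n I I-homogeneous w w-linear (suc (suc d)) (s≤s (s≤s z≤n)) w-regular r =
  mk⇔ (μ-I⇒μ-I+⟨w⟩ r) (μ-I+⟨w⟩⇒μ-I r)
  where open Polynomials.RegularLinearForm K n I I-homogeneous w w-linear d w-regular
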